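{- For every $q\ge2$ and $m\ge0$, the fractal matrix $M_{q,m}$, whose rows are read as star patterns, defines a partition of the hypercube ${\bf Z}_q^{(q^m-1)/(q-1)}$ into $q^m$ subcubes, each of dimension $\frac{q^m-1}{q-1}-m$.
   Context: $M_{q,0}$ is the $1\times 0$ matrix; for $m\ge1$, $M_{q,m}$ is the matrix over ${\bf Z}_q\cup\{*\}$ whose rows are split into $q$ consecutive blocks $B_0,\dots,B_{q-1}$, each with as many rows as $M_{q,m-1}$; its first column equals $a$ on every row of $B_a$; its remaining columns are split into $q$ consecutive groups $G_0,\dots,G_{q-1}$, each with as many columns as $M_{q,m-1}$; the submatrix on $B_a\times G_a$ is $M_{q,m-1}$ and the submatrix on $B_a\times G_b$ for $b\ne a$ consists only of $*$. A row $(x_1,\dots,x_N)\in({\bf Z}_q\cup\{*\})^N$ (a star pattern) defines the subcube $\{v\in{\bf Z}_q^N: v_i=x_i \text{ whenever } x_i\in{\bf Z}_q\}$, whose dimension is the number of $*$ entries. A set of rows defines a partition if these subcubes are pairwise disjoint and cover ${\bf Z}_q^N$. -}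

module Defs where

open import Data.Nat using (ℕ; zero; suc; _+_; _*_)
open import Data.Fin using (Fin; _≟_)
open import Data.Maybe using (Maybe; just; nothing)
open import Data.Vec using (Vec; []; _∷_; replicate; lookup)
open import Data.List using (List; []; _∷_; concatMap; map; length; allFin) renaming (lookup to lookupL)
open import Data.Product using (Σ; ∃; _×_; _,_)
open import Relation.Nullary using (¬_; yes; no)
open import Relation.Binary.PropositionalEquality using (_≡_; _≢_)

-- An entry of the matrix: just a ∈ Z_q, or nothing = the symbol *.
Entry : ℕ → Set
Entry q = Maybe (Fin q)

cols : ℕ → ℕ → ℕ
cols q zero    = 0
cols q (suc m) = suc (q * cols q m)

Row : ℕ → ℕ → Set
Row q n = Vec (Entry q) n

groups : {q : ℕ} (p n : ℕ) → (Fin p → Row q n) → Row q (p * n)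
groups zero    n f = []
groups (suc p) n f = f Data.Fin.zero Data.Vec.++ groups p n (λ b → f (Data.Fin.suc b))

blockRow : (q n : ℕ) → Fin q → Row q n → Row q (suc (q * n))
blockRow q n a r = just a ∷ groups q n (λ b → f b)
  where
  f : Fin q → Row q n
  f b with b ≟ a
  ... | yes _ = r
  ... | no  _ = replicate n nothing

M : (q m : ℕ) → List (Row q (cols q m))
M q zero    = [] ∷ []
M q (suc m) = concatMap (λ a → map (blockRow q (cols q m) a) (M q m)) (allFin q)

InCube : {q n : ℕ} → Row q n → Vec (Fin q) n → Set
InCube {q} {n} x v = ∀ (i : Fin n) (c : Fin q) → lookup x i ≡ just c → lookup v i ≡ c

stars : {q n : ℕ} → Row q n → ℕ
stars []            = 0
stars (nothing ∷ x) = suc (stars x)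
stars (just _ ∷ x)  = stars x

IsPartition : {q n : ℕ} → List (Row q n) → Set
IsPartition {q} {n} rs =
  (∀ (i j : Fin (length rs)) → i ≢ j →
     ¬ (Σ (Vec (Fin q) n) λ v → InCube (lookupL rs i) v × InCube (lookupL rs j) v))
  × (∀ (v : Vec (Fin q) n) → Σ (Fin (length rs)) λ i → InCube (lookupL rs i) v)

{-# OPTIONS --safe #-}

-- A row of M_{q,m+1} in block a is a ∷ (r in group a, stars elsewhere) for a row r of
-- M_{q,m}. So a point c ∷ w lies in its cube iff a = c and the c-th group of w lies in the
-- cube of r: the rows of M_{q,m+1} whose cube contains c ∷ w correspond to the rows of
-- M_{q,m} whose cube contains the c-th group of w, and disjointness and covering pass
-- from m to m + 1. Each row fixes one coordinate more than the row it comes from, so the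
-- rows of M_{q,m} fix exactly m coordinates; and q^m = 1 + (q - 1) cols q m.

module Submission where

open import Defs
open import Data.Nat using (ℕ; _+_; _^_; _∸_)
open import Data.Nat.DivMod using (_/_)
open import Data.List using (length)
open import Data.List.Relation.Unary.All using (All)
open import Data.Product using (_×_)
open import Relation.Binary.PropositionalEquality using (_≡_)

open import Data.Nat using (zero; suc; _*_; NonZero)
open import Data.Nat.Properties using (m+n∸n≡m; +-identityʳ; +-suc)
open import Data.Nat.DivMod using (m*n/n≡m)
open import Data.Nat.Solver using (module +-*-Solver)
open import Data.Fin using (Fin; _≟_)
open import Data.Fin.Properties using (suc-injective)
open import Data.Maybe using (just; nothing)
open import Data.Maybe.Properties using (just-injective)
open import Data.Vec as Vec using (Vec; []; _∷_; _++_; replicate; concat; group)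
open import Data.Vec.Relation.Binary.Pointwise.Inductive as Pointwise
  using (Pointwise; []; _∷_)
open import Data.Vec.Relation.Binary.Pointwise.Extensional using (ext; extensional⇒inductive)
open import Data.List as List using (List; []; _∷_; concatMap; allFin)
open import Data.List.Properties using (length-++; length-map; length-tabulate)
open import Data.List.Membership.Propositional.Properties using (∈-lookup)
open import Data.List.Relation.Unary.All as All using ([]; _∷_)
import Data.List.Relation.Unary.All.Properties as All
open import Data.List.Relation.Unary.Any as Any using (Any; here)
import Data.List.Relation.Unary.Any.Properties as Any
open import Data.List.Relation.Unary.AllPairs as AllPairs using (AllPairs; []; _∷_)
import Data.List.Relation.Unary.AllPairs.Properties as AllPairs
open import Data.List.Relation.Unary.Unique.Propositional.Properties using (allFin⁺)
open import Data.Product using (Σ; ∃; _,_; proj₁)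
open import Data.Empty using (⊥-elim)
open import Function using (id; _∘_; _⇔_; mk⇔; module Equivalence)
open import Relation.Nullary using (¬_; yes; no)
open import Relation.Binary using (REL; Symmetric)
open import Relation.Binary.PropositionalEquality using (refl; sym; trans; cong; cong₂; subst; _≢_; module ≡-Reasoning)

private
  variable
    q n p : ℕ

-- Phrased so that InCube x v is, definitionally, ∀ i → Fits (lookup x i) (lookup v i).
Fits : Entry q → Fin q → Set
Fits e c = ∀ d → e ≡ just d → c ≡ d

InCube⇔Pointwise : {x : Row q n} {v : Vec (Fin q) n} → InCube x v ⇔ Pointwise Fits x v
InCube⇔Pointwise = mk⇔ (extensional⇒inductive ∘ ext) Pointwise.lookup

Pointwise-replicate : ∀ {a b ℓ} {A : Set a} {B : Set b} {R : REL A B ℓ} {x : A} →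
                      (∀ {y} → R x y) → (ys : Vec B n) → Pointwise R (replicate n x) ys
Pointwise-replicate Rx []       = []
Pointwise-replicate Rx (y ∷ ys) = Rx ∷ Pointwise-replicate Rx ys

module _ {b ℓ} {B : Set b} {R : REL (Entry q) B ℓ} where

  Pointwise-groups⁻ : {G : Fin p → Row q n} (wss : Vec (Vec B n) p) → Pointwise R (groups p n G) (concat wss) →
                      ∀ i → Pointwise R (G i) (Vec.lookup wss i)
  Pointwise-groups⁻ {G = G} (ws ∷ wss) h Fin.zero    = Pointwise.++ˡ⁻ (G Fin.zero) ws h
  Pointwise-groups⁻ {G = G} (ws ∷ wss) h (Fin.suc i) =
    Pointwise-groups⁻ {G = G ∘ Fin.suc} wss (Pointwise.++ʳ⁻ (G Fin.zero) ws h) i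

  Pointwise-groups⁺ : {G : Fin p → Row q n} (wss : Vec (Vec B n) p) →
                      (∀ i → Pointwise R (G i) (Vec.lookup wss i)) → Pointwise R (groups p n G) (concat wss)
  Pointwise-groups⁺ []         h = []
  Pointwise-groups⁺ (ws ∷ wss) h = Pointwise.++⁺ (h Fin.zero) (Pointwise-groups⁺ wss (h ∘ Fin.suc))

-- blockRow's group function lives in a where-clause of Defs; unification recovers it.
blockGroups : (q n : ℕ) → Fin q → Row q n → Fin q → Row q n
blockGroups q n a r = proj₁ unfolded
  where
  unfolded : Σ (Fin q → Row q n) λ G → blockRow q n a r ≡ just a ∷ groups q n G
  unfolded = _ , refl

blockGroups-self : (a : Fin q) (r : Row q n) → blockGroups q n a r a ≡ r
blockGroups-self a r with a ≟ a
... | yes _   = refl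
... | no a≢a = ⊥-elim (a≢a refl)

Fits-blockRow⁻ : {a c : Fin q} {r : Row q n} (wss : Vec (Vec (Fin q) n) q) →
                 Pointwise Fits (blockRow q n a r) (c ∷ concat wss) → Pointwise Fits r (Vec.lookup wss a)
Fits-blockRow⁻ {a = a} {r = r} wss (_ ∷ h) =
  subst (λ x → Pointwise Fits x _) (blockGroups-self a r) (Pointwise-groups⁻ wss h a)

Fits-blockRow⁺ : {a : Fin q} {r : Row q n} (wss : Vec (Vec (Fin q) n) q) →
                 Pointwise Fits r (Vec.lookup wss a) →
                 Pointwise Fits (blockRow q n a r) (a ∷ concat wss)
Fits-blockRow⁺ {q} {n} {a} {r} wss h = (λ _ → just-injective) ∷ Pointwise-groups⁺ wss fitsGroup
  where
  fitsGroup : ∀ b → Pointwise Fits (blockGroups q n a r b) (Vec.lookup wss b)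
  fitsGroup b with b ≟ a
  ... | yes refl = h
  ... | no _     = Pointwise-replicate (λ _ ()) _

Disjoint : Row q n → Row q n → Set
Disjoint {q} {n} x y = ¬ ∃ λ (v : Vec (Fin q) n) → Pointwise Fits x v × Pointwise Fits y v

Disjoint-sym : {x y : Row q n} → Disjoint x y → Disjoint y x
Disjoint-sym x#y (v , hy , hx) = x#y (v , hx , hy)

blockRow-disjoint-blocks : {a b : Fin q} {r s : Row q n} → a ≢ b → Disjoint (blockRow q n a r) (blockRow q n b s)
blockRow-disjoint-blocks {a = a} {b} a≢b (_ ∷ _ , c∼a ∷ _ , c∼b ∷ _) = a≢b (trans (sym (c∼a a refl)) (c∼b b refl))

blockRow-disjoint-rows : {a : Fin q} {r s : Row q n} → Disjoint r s → Disjoint (blockRow q n a r) (blockRow q n a s)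
blockRow-disjoint-rows {q} {n} r#s (c ∷ w , hr , hs) with group q n w
... | wss , refl = r#s (_ , Fits-blockRow⁻ wss hr , Fits-blockRow⁻ wss hs)

M-disjoint : ∀ q m → AllPairs Disjoint (M q m)
M-disjoint q zero    = [] ∷ []
M-disjoint q (suc m) = AllPairs.concat⁺ (All.map⁺ (All.tabulate⁺ withinBlock)) (AllPairs.map⁺ acrossBlocks)
  where
  withinBlock : ∀ a → AllPairs Disjoint (List.map (blockRow q (cols q m) a) (M q m))
  withinBlock a = AllPairs.map⁺ (AllPairs.map blockRow-disjoint-rows (M-disjoint q m))
  acrossBlocks : AllPairs (λ a b → All (λ x → All (Disjoint x) (List.map (blockRow q (cols q m) b) (M q m)))
                                      (List.map (blockRow q (cols q m) a) (M q m)))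
                          (allFin q)
  acrossBlocks = AllPairs.map (λ a≢b → All.map⁺ (All.universal (λ _ → All.map⁺ (All.universal
                                 (λ _ → blockRow-disjoint-blocks a≢b) _)) _))
                              (allFin⁺ q)

M-covers : ∀ q m (v : Vec (Fin q) (cols q m)) → Any (λ r → Pointwise Fits r v) (M q m)
M-covers q zero    []      = here []
M-covers q (suc m) (c ∷ w) with group q (cols q m) w
... | wss , refl = Any.concatMap⁺ _ (Any.tabulate⁺ c (Any.map⁺
                     (Any.map (Fits-blockRow⁺ wss) (M-covers q m (Vec.lookup wss c)))))

AllPairs-lookup : ∀ {a ℓ} {A : Set a} {R : A → A → Set ℓ} → Symmetric R →
                  {xs : List A} → AllPairs R xs →
                  {i j : Fin (length xs)} → i ≢ j → R (List.lookup xs i) (List.lookup xs j)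
AllPairs-lookup R-sym (Rx ∷ Rxs) {Fin.zero}  {Fin.zero}  i≢j = ⊥-elim (i≢j refl)
AllPairs-lookup R-sym (Rx ∷ Rxs) {Fin.zero}  {Fin.suc j} i≢j = All.lookup Rx (∈-lookup j)
AllPairs-lookup R-sym (Rx ∷ Rxs) {Fin.suc i} {Fin.zero}  i≢j = R-sym (All.lookup Rx (∈-lookup i))
AllPairs-lookup R-sym (Rx ∷ Rxs) {Fin.suc i} {Fin.suc j} i≢j = AllPairs-lookup R-sym Rxs (i≢j ∘ cong Fin.suc)

isPartition : {rs : List (Row q n)} → AllPairs Disjoint rs →
              (∀ v → Any (λ r → Pointwise Fits r v) rs) → IsPartition rs
isPartition disjoint covers =
  (λ i j i≢j (v , hi , hj) → AllPairs-lookup Disjoint-sym disjoint i≢j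
                                 (v , to InCube⇔Pointwise hi , to InCube⇔Pointwise hj)) ,
  (λ v → Any.index (covers v) , from InCube⇔Pointwise (Any.lookup-index (covers v)))
  where open Equivalence

M-isPartition : ∀ q m → IsPartition (M q m)
M-isPartition q m = isPartition (M-disjoint q m) (M-covers q m)

codim : Row q n → ℕ
codim []            = 0
codim (nothing ∷ x) = codim x
codim (just _ ∷ x)  = suc (codim x)

stars+codim : (x : Row q n) → stars x + codim x ≡ n
stars+codim []            = refl
stars+codim (nothing ∷ x) = cong suc (stars+codim x)
stars+codim (just _ ∷ x)  = trans (+-suc (stars x) (codim x)) (cong suc (stars+codim x))

codim-++ : ∀ {m} (x : Row q m) (y : Row q n) → codim (x ++ y) ≡ codim x + codim y
codim-++ []            y = refl
codim-++ (nothing ∷ x) y = codim-++ x y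
codim-++ (just _ ∷ x)  y = cong suc (codim-++ x y)

codim-replicate-nothing : ∀ n → codim {q} (replicate n nothing) ≡ 0
codim-replicate-nothing zero    = refl
codim-replicate-nothing (suc n) = codim-replicate-nothing n

codim-groups≡0 : {G : Fin p → Row q n} → (∀ b → codim (G b) ≡ 0) → codim (groups p n G) ≡ 0
codim-groups≡0 {zero}  G0 = refl
codim-groups≡0 {suc p} {G = G} G0 =
  trans (codim-++ (G Fin.zero) _) (cong₂ _+_ (G0 Fin.zero) (codim-groups≡0 (G0 ∘ Fin.suc)))

codim-groups : {G : Fin p → Row q n} (a : Fin p) → (∀ b → b ≢ a → codim (G b) ≡ 0) →
               codim (groups p n G) ≡ codim (G a)
codim-groups {G = G} Fin.zero G0 =
  trans (codim-++ (G Fin.zero) _)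
        (trans (cong (codim (G Fin.zero) +_) (codim-groups≡0 (λ b → G0 (Fin.suc b) λ ()))) (+-identityʳ _))
codim-groups {G = G} (Fin.suc a) G0 =
  trans (codim-++ (G Fin.zero) _)
        (cong₂ _+_ (G0 Fin.zero λ ()) (codim-groups a (λ b b≢a → G0 (Fin.suc b) (b≢a ∘ suc-injective))))

codim-blockRow : (a : Fin q) (r : Row q n) → codim (blockRow q n a r) ≡ suc (codim r)
codim-blockRow {n = n} a r = cong suc (trans (codim-groups a unchosen) (cong codim (blockGroups-self a r)))
  where
  unchosen : ∀ b → b ≢ a → codim (blockGroups _ n a r b) ≡ 0
  unchosen b b≢a with b ≟ a
  ... | yes b≡a = ⊥-elim (b≢a b≡a)
  ... | no _    = codim-replicate-nothing n

M-codim : ∀ q m → All (λ r → codim r ≡ m) (M q m)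
M-codim q zero    = refl ∷ []
M-codim q (suc m) = All.concat⁺ (All.map⁺ (All.tabulate⁺ λ a →
  All.map⁺ (All.map (λ {r} codim≡m → trans (codim-blockRow a r) (cong suc codim≡m)) (M-codim q m))))

M-stars : ∀ q m → All (λ r → stars r ≡ cols q m ∸ m) (M q m)
M-stars q m = All.map (λ {r} codim≡m → begin
    stars r                    ≡⟨ m+n∸n≡m (stars r) m ⟨
    stars r + m ∸ m            ≡⟨ cong (λ k → stars r + k ∸ m) codim≡m ⟨
    stars r + codim r ∸ m      ≡⟨ cong (_∸ m) (stars+codim r) ⟩
    cols q m ∸ m               ∎) (M-codim q m)
  where open ≡-Reasoning

length-concatMap-const : ∀ {a b} {A : Set a} {B : Set b} {f : A → List B} {k} →
                         (∀ x → length (f x) ≡ k) → ∀ xs → length (concatMap f xs) ≡ length xs * k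
length-concatMap-const {f = f} fk []       = refl
length-concatMap-const {f = f} fk (x ∷ xs) =
  trans (length-++ (f x)) (cong₂ _+_ (fk x) (length-concatMap-const fk xs))

M-length : ∀ q m → length (M q m) ≡ q ^ m
M-length q zero    = refl
M-length q (suc m) = begin
  length (M q (suc m))                ≡⟨ length-concatMap-const (λ a → length-map (blockRow q (cols q m) a) (M q m)) (allFin q) ⟩
  length (allFin q) * length (M q m)  ≡⟨ cong₂ _*_ (length-tabulate {n = q} id) (M-length q m) ⟩
  q * q ^ m                           ∎
  where open ≡-Reasoning

^≡1+cols* : ∀ p m → suc p ^ m ≡ suc (cols (suc p) m * p)
^≡1+cols* p zero    = refl
^≡1+cols* p (suc m) = trans (cong (suc p *_) (^≡1+cols* p m)) (step p (cols (suc p) m))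
  where
  open +-*-Solver
  step : ∀ p c → suc p * suc (c * p) ≡ suc (suc (suc p * c) * p)
  step = solve 2 (λ p c → (con 1 :+ p) :* (con 1 :+ c :* p) := con 1 :+ (con 1 :+ (con 1 :+ p) :* c) :* p) refl

cols-closedForm : ∀ p m .{{_ : NonZero p}} → cols (suc p) m ≡ (suc p ^ m ∸ 1) / p
cols-closedForm p m = begin
  cols (suc p) m                 ≡⟨ m*n/n≡m (cols (suc p) m) p ⟨
  cols (suc p) m * p / p         ≡⟨ cong (λ k → (k ∸ 1) / p) (^≡1+cols* p m) ⟨
  (suc p ^ m ∸ 1) / p            ∎
  where open ≡-Reasoning

mainTheorem13 : (k m : ℕ) →
    cols (2 + k) m ≡ ((2 + k) ^ m ∸ 1) / ((2 + k) ∸ 1)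
    × length (M (2 + k) m) ≡ (2 + k) ^ m
    × IsPartition (M (2 + k) m)
    × All (λ r → stars r ≡ cols (2 + k) m ∸ m) (M (2 + k) m)
mainTheorem13 k m = cols-closedForm (suc k) m , M-length (2 + k) m , M-isPartition (2 + k) m , M-stars (2 + k) m
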